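{- Let $\alpha$ be a node of $T$, $(d,k)\in R_\alpha$, $v\in X_\alpha$, and $p>0$ an integer with $k+p\le|Y_\alpha|$. Let $d_m:X_\alpha\to\mathbb{N}$ be given by $d_m(v)=d(v)+p$ and $d_m(u)=d(u)$ for $u\in X_\alpha\setminus\{v\}$. Then $(d_m,|Y_\alpha|)\in R_\alpha$ if and only if $(d_m,k+p)\in R_\alpha$.
   Context: $G=(V,E)$ is a simple undirected graph and $c:V\to\mathbb{N}$ a capacity function; $(T,\mathcal{X})$ is a (nice) tree decomposition of $G$ with bags $X_\alpha$. For a node $\alpha$, $V_\alpha$ is the union of the bags in the subtree rooted at $\alpha$, $Y_\alpha=V_\alpha\setminus X_\alpha$, and $G_\alpha$ is the graph with vertex set $V_\alpha$ and edge set $E[V_\alpha]\setminus E[X_\alpha]$. $R_\alpha$ is the set of pairs $(d,k)$ with $d:X_\alpha\to\mathbb{N}$, $k\in\mathbb{N}$, for which there is an orientation $O$ of $G_\alpha$ with: (1) $d(v)$ equals the out-degree of $v$ in $O$ for all $v\in X_\alpha$; (2) the in-degree of $v$ in $O$ is at most $c(v)$ for all $v\in Y_\alpha$; (3) the number of $v\in Y_\alpha$ with positive in-degree in $O$ is at most $k$, and $k\le|Y_\alpha|$. -}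

module Defs where

open import Data.Nat using (ℕ; zero; suc; _+_; _≤_; _<ᵇ_)
open import Data.Fin using (Fin; zero; suc; _≟_)
open import Data.Bool using (Bool; true; false; _∧_; _∨_; not; if_then_else_)
open import Data.Product using (Σ; _×_; ∃)
open import Data.Sum using (_⊎_)
open import Relation.Nullary.Decidable using (⌊_⌋)
open import Relation.Binary.PropositionalEquality using (_≡_)

countF : ∀ {n} → (Fin n → Bool) → ℕ
countF {zero}  P = 0
countF {suc n} P = (if P zero then 1 else 0) + countF (λ i → P (suc i))

anyF : ∀ {n} → (Fin n → Bool) → Bool
anyF {zero}  P = false
anyF {suc n} P = P zero ∨ anyF (λ i → P (suc i))

_==_ : ∀ {n} → Fin n → Fin n → Bool
i == j = ⌊ i ≟ j ⌋

iter : ∀ {A : Set} → ℕ → (A → A) → A → A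
iter zero    f x = x
iter (suc k) f x = f (iter k f x)

record Graph (n : ℕ) : Set where
  field
    E      : Fin n → Fin n → Bool
    sym    : ∀ u v → E u v ≡ E v u
    irrefl : ∀ v → E v v ≡ false
open Graph public

record TreeDecomposition {n : ℕ} (G : Graph n) : Set where
  field
    m        : ℕ
    root     : Fin m
    parent   : Fin m → Fin m
    rootFix  : parent root ≡ root
    reach    : ∀ β → ∃ λ k → iter k parent β ≡ root
    bag      : Fin m → Fin n → Bool
    covV     : ∀ v → ∃ λ β → bag β v ≡ true
    covE     : ∀ u v → E G u v ≡ true → ∃ λ β → (bag β u ≡ true × bag β v ≡ true)
    -- the nodes whose bag contains v form a connected subtree:
    -- it has a unique topmost node (node β with v ∈ bag β such that β is the
    -- root or v ∉ bag (parent β))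
    conn     : ∀ v β γ →
               bag β v ≡ true → (β ≡ root ⊎ bag (parent β) v ≡ false) →
               bag γ v ≡ true → (γ ≡ root ⊎ bag (parent γ) v ≡ false) →
               β ≡ γ
open TreeDecomposition public

module _ {n : ℕ} {G : Graph n} (td : TreeDecomposition G) where

  -- β is a descendant of α (β itself included): α occurs among the
  -- iterated parents of β (m iterations suffice in a tree with m nodes).
  isDesc : Fin (m td) → Fin (m td) → Bool
  isDesc β α = go (m td) β
    where
    go : ℕ → Fin (m td) → Bool
    go zero    γ = γ == α
    go (suc f) γ = (γ == α) ∨ go f (parent td γ)

  Xs : Fin (m td) → Fin n → Bool
  Xs α v = bag td α v

  Vs : Fin (m td) → Fin n → Bool
  Vs α v = anyF (λ β → isDesc β α ∧ bag td β v)

  Ys : Fin (m td) → Fin n → Bool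
  Ys α v = Vs α v ∧ not (Xs α v)

  Eα : Fin (m td) → Fin n → Fin n → Bool
  Eα α u w = E G u w ∧ Vs α u ∧ Vs α w ∧ not (Xs α u ∧ Xs α w)

  -- O u w ≡ true means the edge uw is oriented u → w.
  IsOrientation : Fin (m td) → (Fin n → Fin n → Bool) → Set
  IsOrientation α O =
    (∀ u w → O u w ≡ true → Eα α u w ≡ true) ×
    (∀ u w → Eα α u w ≡ true → (O u w ≡ true ⊎ O w u ≡ true)) ×
    (∀ u w → O u w ≡ true → O w u ≡ false)

  outdeg : (Fin n → Fin n → Bool) → Fin n → ℕ
  outdeg O u = countF (λ w → O u w)

  indeg : (Fin n → Fin n → Bool) → Fin n → ℕ
  indeg O u = countF (λ w → O w u)

  sizeY : Fin (m td) → ℕ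
  sizeY α = countF (Ys α)

  -- (d , k) ∈ R_α   (only the values of d on X_α matter)
  InR : (c : Fin n → ℕ) → (α : Fin (m td)) → (d : Fin n → ℕ) → ℕ → Set
  InR c α d k = Σ (Fin n → Fin n → Bool) λ O →
    IsOrientation α O ×
    (∀ v → Xs α v ≡ true → d v ≡ outdeg O v) ×
    (∀ v → Ys α v ≡ true → indeg O v ≤ c v) ×
    (countF (λ v → Ys α v ∧ (0 <ᵇ indeg O v)) ≤ k) ×
    (k ≤ sizeY α)

raiseAt : ∀ {n} → (Fin n → ℕ) → Fin n → ℕ → Fin n → ℕ
raiseAt d v p u = if u == v then d u + p else d u

-- Let O witness (d , k) ∈ R_α and B witness (d_m , |Y_α|) ∈ R_α.  Starting from O we perform
-- p augmentations towards B.  An augmentation starts at v, where the current orientation has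
-- fewer out-arcs than B, and repeatedly reverses an arc that B orients the other way, moving
-- to its head, until it reaches a vertex whose out-degree has caught up with B.  That vertex
-- cannot lie in X_α, where out-degrees are prescribed, so it lies in Y_α, and its in-degree is
-- then at most its in-degree in B, hence within capacity.  The augmentation raises the
-- out-degree of v by one and changes no other out-degree on X_α; on Y_α it raises exactly
-- one in-degree, by one.  So after p augmentations the in-degrees on Y_α have only grown, by p
-- in total, and at most k + p vertices of Y_α have positive in-degree.  Every reversal removes
-- one arc of B missing from the current orientation, which bounds the length of the walks.

module Submission where

open import Defs hiding (sym)
open import Data.Nat using (ℕ; zero; suc; _+_; _≤_; _<_; _<ᵇ_; z≤n; s≤s)
import Data.Nat.Properties as ℕ
open import Data.Nat.Tactic.RingSolver using (solve-∀)
open import Data.Fin using (Fin; zero; suc; _≟_; punchIn)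
open import Data.Fin.Properties using (punchInᵢ≢i)
open import Data.Bool using (Bool; true; false; _∧_; _∨_; not; if_then_else_)
open import Data.Bool.Properties using (∨-zeroʳ; not-¬)
open import Data.Product using (∃; _×_; _,_; proj₁; proj₂; map)
open import Data.Sum using (_⊎_; inj₁; inj₂)
open import Function.Base using (_∘_; id)
open import Function.Bundles using (_⇔_; mk⇔)
open import Relation.Nullary using (¬_; Dec; yes; no; contradiction)
open import Relation.Binary.PropositionalEquality
open import Algebra.Properties.CommutativeMonoid.Sum ℕ.+-0-commutativeMonoid
  using (sum; sum-cong-≗; sum-remove; ∑-distrib-+)

BoolRel : ℕ → Set
BoolRel n = Fin n → Fin n → Bool

iverson : Bool → ℕ
iverson b = if b then 1 else 0

δ : ∀ {n} → Fin n → Fin n → ℕ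
δ i j = iverson (i == j)

==-refl : ∀ {n} (i : Fin n) → (i == i) ≡ true
==-refl i with i ≟ i
... | yes _   = refl
... | no i≢i = contradiction refl i≢i

==-≢ : ∀ {n} {i j : Fin n} → i ≢ j → (i == j) ≡ false
==-≢ {i = i} {j} i≢j with i ≟ j
... | yes i≡j = contradiction i≡j i≢j
... | no _    = refl

δ-refl : ∀ {n} (i : Fin n) → δ i i ≡ 1
δ-refl i = cong iverson (==-refl i)

δ-≢ : ∀ {n} {i j : Fin n} → i ≢ j → δ i j ≡ 0
δ-≢ i≢j = cong iverson (==-≢ i≢j)

+-δ-≢ : ∀ {n} m {i j : Fin n} → i ≢ j → m + δ i j ≡ m
+-δ-≢ m i≢j = trans (cong (m +_) (δ-≢ i≢j)) (ℕ.+-identityʳ m)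

sum-update : ∀ {n} {f g : Fin n → ℕ} (i : Fin n) → (∀ j → j ≢ i → f j ≡ g j) →
             sum f + g i ≡ sum g + f i
sum-update {suc n} {f} {g} i f≐g = begin
  sum f + g i                      ≡⟨ cong (_+ g i) (sum-remove {i = i} f) ⟩
  f i + sum (f ∘ punchIn i) + g i  ≡⟨ cong (λ s → f i + s + g i) off-i ⟩
  f i + sum (g ∘ punchIn i) + g i  ≡⟨ swap (f i) _ (g i) ⟩
  g i + sum (g ∘ punchIn i) + f i  ≡⟨ cong (_+ f i) (sym (sum-remove {i = i} g)) ⟩
  sum g + f i                      ∎
  where
  open ≡-Reasoning
  off-i : sum (f ∘ punchIn i) ≡ sum (g ∘ punchIn i)
  off-i = sum-cong-≗ (λ j → f≐g (punchIn i j) (punchInᵢ≢i i j))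
  swap : ∀ a b c → a + b + c ≡ c + b + a
  swap = solve-∀

sum-mono : ∀ {n} {f g : Fin n → ℕ} → (∀ i → f i ≤ g i) → sum f ≤ sum g
sum-mono {zero}  f≤g = z≤n
sum-mono {suc n} f≤g = ℕ.+-mono-≤ (f≤g zero) (sum-mono (f≤g ∘ suc))

countF≡sum : ∀ {n} (P : Fin n → Bool) → countF P ≡ sum (iverson ∘ P)
countF≡sum {zero}  P = refl
countF≡sum {suc n} P = cong (iverson (P zero) +_) (countF≡sum (P ∘ suc))

countF-cong : ∀ {n} {P Q : Fin n → Bool} → (∀ i → P i ≡ Q i) → countF P ≡ countF Q
countF-cong {P = P} {Q} P≐Q = begin
  countF P          ≡⟨ countF≡sum P ⟩
  sum (iverson ∘ P) ≡⟨ sum-cong-≗ (cong iverson ∘ P≐Q) ⟩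
  sum (iverson ∘ Q) ≡⟨ countF≡sum Q ⟨
  countF Q          ∎
  where open ≡-Reasoning

countF-update : ∀ {n} {P Q : Fin n → Bool} {a b : Bool} (i : Fin n) →
                (∀ j → j ≢ i → P j ≡ Q j) → P i ≡ a → Q i ≡ b →
                countF P + iverson b ≡ countF Q + iverson a
countF-update {P = P} {Q} i P≐Q refl refl
  rewrite countF≡sum P | countF≡sum Q = sum-update i (λ j j≢i → cong iverson (P≐Q j j≢i))

countF-< : ∀ {n} (P Q : Fin n → Bool) → countF P < countF Q →
           ∃ λ i → P i ≡ false × Q i ≡ true
countF-< {suc n} P Q lt with P zero in P₀ | Q zero in Q₀
... | false | true  = zero , P₀ , Q₀
... | false | false = map suc id (countF-< (P ∘ suc) (Q ∘ suc) lt)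
... | true  | true  = map suc id (countF-< (P ∘ suc) (Q ∘ suc) (ℕ.≤-pred lt))
... | true  | false = map suc id (countF-< (P ∘ suc) (Q ∘ suc) (ℕ.<-trans (ℕ.n<1+n _) lt))

complementary-shift : ∀ {a b a′ b′ x y : ℕ} →
                      a′ + b′ ≡ a + b → a′ + x ≡ a + y → b′ + y ≡ b + x
complementary-shift {a} {b} {a′} {b′} {x} {y} total shift = ℕ.+-cancelˡ-≡ (a′ + x) _ _ (begin
  (a′ + x) + (b′ + y) ≡⟨ interchange a′ x b′ y ⟩
  (a′ + b′) + (x + y) ≡⟨ cong (_+ (x + y)) total ⟩
  (a + b) + (x + y)   ≡⟨ regroup a b x y ⟩
  (a + y) + (b + x)   ≡⟨ cong (_+ (b + x)) shift ⟨
  (a′ + x) + (b + x)  ∎)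
  where
  open ≡-Reasoning
  interchange : ∀ a x b y → (a + x) + (b + y) ≡ (a + b) + (x + y)
  interchange = solve-∀
  regroup : ∀ a b x y → (a + b) + (x + y) ≡ (a + y) + (b + x)
  regroup = solve-∀

complementary-≤ : ∀ {a b a′ b′ : ℕ} → a′ + b′ ≡ a + b → a ≤ a′ → b′ ≤ b
complementary-≤ {a} {b} {a′} {b′} total a≤a′ =
  ℕ.+-cancelˡ-≤ a b′ b (ℕ.≤-trans (ℕ.+-monoˡ-≤ b′ a≤a′) (ℕ.≤-reflexive total))

-- `IsOrientation td α` unfolds to `Orientation (Eα td α)`, so the lemmas below apply to it.
Orientation : ∀ {n} → BoolRel n → BoolRel n → Set
Orientation E A =
  (∀ u w → A u w ≡ true → E u w ≡ true) ×
  (∀ u w → E u w ≡ true → (A u w ≡ true ⊎ A w u ≡ true)) ×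
  (∀ u w → A u w ≡ true → A w u ≡ false)

module _ {n} {E : BoolRel n} where

  unoriented⇒non-edge : ∀ {A} → Orientation E A → ∀ {u w} →
                        A u w ≡ false → A w u ≡ false → E u w ≡ false
  unoriented⇒non-edge (_ , total , _) {u} {w} uw wu with E u w in e
  ... | false = refl
  ... | true with total u w e
  ...   | inj₁ A-uw = contradiction uw (not-¬ A-uw)
  ...   | inj₂ A-wu = contradiction wu (not-¬ A-wu)

  orientation-degree : ∀ {A} → Orientation E A → ∀ u →
    countF (A u) + countF (λ w → A w u) ≡ countF (λ w → E u w ∨ E w u)
  orientation-degree {A} orA@(A⊆E , _ , antisym) u = begin
    countF (A u) + countF (λ w → A w u)
      ≡⟨ cong₂ _+_ (countF≡sum (A u)) (countF≡sum (λ w → A w u)) ⟩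
    sum (iverson ∘ A u) + sum (λ w → iverson (A w u))
      ≡⟨ ∑-distrib-+ (iverson ∘ A u) (λ w → iverson (A w u)) ⟨
    sum (λ w → iverson (A u w) + iverson (A w u))
      ≡⟨ sum-cong-≗ arcs-cover-edge ⟩
    sum (λ w → iverson (E u w ∨ E w u))
      ≡⟨ countF≡sum (λ w → E u w ∨ E w u) ⟨
    countF (λ w → E u w ∨ E w u)
      ∎
    where
    open ≡-Reasoning
    arcs-cover-edge : ∀ w → iverson (A u w) + iverson (A w u) ≡ iverson (E u w ∨ E w u)
    arcs-cover-edge w with A u w in uw | A w u in wu
    ... | true  | true  = contradiction (antisym u w uw) (not-¬ wu)
    ... | true  | false rewrite A⊆E u w uw = refl
    ... | false | true  rewrite A⊆E w u wu | ∨-zeroʳ (E u w) = refl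
    ... | false | false
      rewrite unoriented⇒non-edge orA uw wu | unoriented⇒non-edge orA wu uw = refl

  orientation-degree-invariant : ∀ {A A′} → Orientation E A → Orientation E A′ → ∀ u →
    countF (A′ u) + countF (λ w → A′ w u) ≡ countF (A u) + countF (λ w → A w u)
  orientation-degree-invariant orA orA′ u =
    trans (orientation-degree orA′ u) (sym (orientation-degree orA u))

redirect : ∀ {n} → BoolRel n → Fin n → Fin n → BoolRel n
redirect A t w a b =
  if a == t then (if b == w then true else A a b)
  else if a == w then (if b == t then false else A a b)
  else A a b

data ArcPosition {n} (t w a b : Fin n) : Set where
  forward   : a ≡ t → b ≡ w → ArcPosition t w a b
  backward  : a ≡ w → b ≡ t → ArcPosition t w a b
  elsewhere : ¬ (a ≡ t × b ≡ w) → ¬ (a ≡ w × b ≡ t) → ArcPosition t w a b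

arcPosition : ∀ {n} (t w a b : Fin n) → ArcPosition t w a b
arcPosition t w a b with a ≟ t | b ≟ w | a ≟ w | b ≟ t
... | yes a≡t | yes b≡w | _       | _       = forward a≡t b≡w
... | _       | _       | yes a≡w | yes b≡t = backward a≡w b≡t
... | yes _   | no b≢w  | no a≢w  | _       = elsewhere (b≢w ∘ proj₂) (a≢w ∘ proj₁)
... | yes _   | no b≢w  | yes _   | no b≢t  = elsewhere (b≢w ∘ proj₂) (b≢t ∘ proj₂)
... | no a≢t  | _       | no a≢w  | _       = elsewhere (a≢t ∘ proj₁) (a≢w ∘ proj₁)
... | no a≢t  | _       | yes _   | no b≢t  = elsewhere (a≢t ∘ proj₁) (b≢t ∘ proj₂)

module _ {n} (A : BoolRel n) (t w : Fin n) where

  redirect-forward : redirect A t w t w ≡ true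
  redirect-forward rewrite ==-refl t | ==-refl w = refl

  redirect-backward : t ≢ w → redirect A t w w t ≡ false
  redirect-backward t≢w rewrite ==-≢ (t≢w ∘ sym) | ==-refl w | ==-refl t = refl

  redirect-elsewhere : ∀ {a b} → ¬ (a ≡ t × b ≡ w) → ¬ (a ≡ w × b ≡ t) →
                       redirect A t w a b ≡ A a b
  redirect-elsewhere {a} {b} not-forward not-backward with a ≟ t
  ... | yes refl rewrite ==-≢ (λ b≡w → not-forward (refl , b≡w)) = refl
  ... | no _ with a ≟ w
  ...   | yes refl rewrite ==-≢ (λ b≡t → not-backward (refl , b≡t)) = refl
  ...   | no _     = refl

disagreement : ∀ {n} → BoolRel n → BoolRel n → ℕ
disagreement B A = sum λ a → countF λ b → B a b ∧ not (A a b)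

module _ {n} {A : BoolRel n} {t w : Fin n}
         (Atw : A t w ≡ false) (Awt : A w t ≡ true) (t≢w : t ≢ w) where

  redirect-orientation : ∀ {E} → Orientation E A → E t w ≡ true → Orientation E (redirect A t w)
  redirect-orientation {E} (A⊆E , A-total , A-antisym) Etw = ⊆E , total , antisym
    where
    swap-elsewhere : ∀ {a b} → ¬ (a ≡ t × b ≡ w) → ¬ (a ≡ w × b ≡ t) →
                     redirect A t w b a ≡ A b a
    swap-elsewhere not-fwd not-bwd =
      redirect-elsewhere A t w (λ (b≡t , a≡w) → not-bwd (a≡w , b≡t))
                               (λ (b≡w , a≡t) → not-fwd (a≡t , b≡w))

    ⊆E : ∀ a b → redirect A t w a b ≡ true → E a b ≡ true
    ⊆E a b e with arcPosition t w a b
    ... | forward refl refl = Etw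
    ... | backward refl refl = contradiction (redirect-backward A t w t≢w) (not-¬ e)
    ... | elsewhere nf nb = A⊆E a b (trans (sym (redirect-elsewhere A t w nf nb)) e)

    total : ∀ a b → E a b ≡ true → redirect A t w a b ≡ true ⊎ redirect A t w b a ≡ true
    total a b e with arcPosition t w a b
    ... | forward refl refl  = inj₁ (redirect-forward A t w)
    ... | backward refl refl = inj₂ (redirect-forward A t w)
    ... | elsewhere nf nb with A-total a b e
    ...   | inj₁ ab = inj₁ (trans (redirect-elsewhere A t w nf nb) ab)
    ...   | inj₂ ba = inj₂ (trans (swap-elsewhere nf nb) ba)

    antisym : ∀ a b → redirect A t w a b ≡ true → redirect A t w b a ≡ false
    antisym a b e with arcPosition t w a b
    ... | forward refl refl  = redirect-backward A t w t≢w
    ... | backward refl refl = contradiction (redirect-backward A t w t≢w) (not-¬ e)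
    ... | elsewhere nf nb =
      trans (swap-elsewhere nf nb) (A-antisym a b (trans (sym (redirect-elsewhere A t w nf nb)) e))

  outdeg-redirect : ∀ u → countF (redirect A t w u) + δ u w ≡ countF (A u) + δ u t
  outdeg-redirect u = by-position (u ≟ t) (u ≟ w)
    where
    by-position : Dec (u ≡ t) → Dec (u ≡ w) →
                  countF (redirect A t w u) + δ u w ≡ countF (A u) + δ u t
    by-position (yes refl) _ rewrite δ-≢ t≢w | δ-refl u =
      countF-update w (λ b b≢w → redirect-elsewhere A u w (b≢w ∘ proj₂) (t≢w ∘ proj₁))
                    (redirect-forward A u w) Atw
    by-position (no u≢t) (yes refl) rewrite δ-refl u | δ-≢ u≢t =
      countF-update t (λ b b≢t → redirect-elsewhere A t u (u≢t ∘ proj₁) (b≢t ∘ proj₂))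
                    (redirect-backward A t u t≢w) Awt
    by-position (no u≢t) (no u≢w) rewrite δ-≢ u≢t | δ-≢ u≢w =
      cong (_+ 0) (countF-cong λ b →
        redirect-elsewhere A t w {u} {b} (u≢t ∘ proj₁) (u≢w ∘ proj₁))

  disagreement-redirect : ∀ {B} → B t w ≡ true → B w t ≡ false →
                          suc (disagreement B (redirect A t w)) ≡ disagreement B A
  disagreement-redirect {B} Btw Bwt = ℕ.+-cancelʳ-≡ (row′ t) _ _ (begin
    suc (disagreement B A′) + row′ t ≡⟨ ℕ.+-suc _ (row′ t) ⟨
    disagreement B A′ + suc (row′ t) ≡⟨ cong (disagreement B A′ +_) row-t ⟩
    disagreement B A′ + row t        ≡⟨ sum-update t rows-off-t ⟩
    disagreement B A + row′ t        ∎)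
    where
    open ≡-Reasoning
    A′ : BoolRel n
    A′ = redirect A t w

    row row′ : Fin n → ℕ
    row  a = countF λ b → B a b ∧ not (A a b)
    row′ a = countF λ b → B a b ∧ not (A′ a b)

    row-t : suc (row′ t) ≡ row t
    row-t = begin
      suc (row′ t) ≡⟨ ℕ.+-comm 1 (row′ t) ⟩
      row′ t + 1   ≡⟨ countF-update w
                        (λ b b≢w → cong (λ y → B t b ∧ not y)
                           (redirect-elsewhere A t w (b≢w ∘ proj₂) (t≢w ∘ proj₁)))
                        (cong₂ (λ x y → x ∧ not y) Btw (redirect-forward A t w))
                        (cong₂ (λ x y → x ∧ not y) Btw Atw) ⟩
      row t + 0    ≡⟨ ℕ.+-identityʳ (row t) ⟩
      row t        ∎

    rows-off-t : ∀ a → a ≢ t → row′ a ≡ row a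
    rows-off-t a a≢t = countF-cong same-entry
      where
      same-entry : ∀ b → (B a b ∧ not (A′ a b)) ≡ (B a b ∧ not (A a b))
      same-entry b with arcPosition t w a b
      ... | forward a≡t _      = contradiction a≡t a≢t
      ... | backward refl refl =
        trans (cong (_∧ not (A′ w t)) Bwt) (cong (_∧ not (A w t)) (sym Bwt))
      ... | elsewhere nf nb    = cong (λ y → B a b ∧ not y) (redirect-elsewhere A t w nf nb)

module _ {n} {E B : BoolRel n} (orB : Orientation E B) where

  record Augmentation (A : BoolRel n) (t : Fin n) : Set where
    field
      A′            : BoolRel n
      end           : Fin n
      orientation   : Orientation E A′
      outdeg-shift  : ∀ u → countF (A′ u) + δ u end ≡ countF (A u) + δ u t
      end-saturated : countF (B end) ≤ countF (A′ end)
      end-on-edge   : ∃ λ u → E u end ≡ true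

  augment : ∀ fuel {A} t → disagreement B A < fuel → Orientation E A →
            countF (A t) < countF (B t) → Augmentation A t
  augment (suc fuel) {A} t bound orA deficit with countF-< (A t) (B t) deficit
  ... | w , Atw , Btw = continue (countF (B w) ℕ.≤? countF (A₁ w))
    where
    Etw : E t w ≡ true
    Etw = proj₁ orB t w Btw

    Bwt : B w t ≡ false
    Bwt = proj₂ (proj₂ orB) t w Btw

    Awt : A w t ≡ true
    Awt with proj₁ (proj₂ orA) t w Etw
    ... | inj₁ Atw′ = contradiction Atw (not-¬ Atw′)
    ... | inj₂ Awt  = Awt

    t≢w : t ≢ w
    t≢w refl = contradiction Bwt (not-¬ Btw)

    A₁ : BoolRel n
    A₁ = redirect A t w

    orA₁ : Orientation E A₁
    orA₁ = redirect-orientation Atw Awt t≢w orA Etw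

    bound₁ : disagreement B A₁ < fuel
    bound₁ = ℕ.≤-pred (subst (_< suc fuel) (sym decrease) bound)
      where
      decrease : suc (disagreement B A₁) ≡ disagreement B A
      decrease = disagreement-redirect Atw Awt t≢w Btw Bwt

    continue : Dec (countF (B w) ≤ countF (A₁ w)) → Augmentation A t
    continue (yes saturated) = record
      { A′ = A₁ ; end = w ; orientation = orA₁
      ; outdeg-shift = outdeg-redirect Atw Awt t≢w
      ; end-saturated = saturated ; end-on-edge = t , Etw }
    continue (no unsaturated) = record
      { A′ = A′ ; end = end ; orientation = orientation
      ; outdeg-shift = λ u → trans (outdeg-shift u) (outdeg-redirect Atw Awt t≢w u)
      ; end-saturated = end-saturated ; end-on-edge = end-on-edge }
      where open Augmentation (augment fuel w bound₁ orA₁ (ℕ.≰⇒> unsaturated))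

module _ {n} (d : Fin n → ℕ) (v : Fin n) where

  raiseAt-at : ∀ j → raiseAt d v j v ≡ d v + j
  raiseAt-at j = cong (λ b → if b then d v + j else d v) (==-refl v)

  raiseAt-off : ∀ {x} j → x ≢ v → raiseAt d v j x ≡ d x
  raiseAt-off {x} j x≢v = cong (λ b → if b then d x + j else d x) (==-≢ x≢v)

  raiseAt-zero : ∀ x → raiseAt d v 0 x ≡ d x
  raiseAt-zero x = by-position (x ≟ v)
    where
    by-position : Dec (x ≡ v) → raiseAt d v 0 x ≡ d x
    by-position (yes refl) = trans (raiseAt-at 0) (ℕ.+-identityʳ (d x))
    by-position (no x≢v)   = raiseAt-off 0 x≢v

  raiseAt-suc : ∀ j x → raiseAt d v j x + δ x v ≡ raiseAt d v (suc j) x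
  raiseAt-suc j x = by-position (x ≟ v)
    where
    by-position : Dec (x ≡ v) → raiseAt d v j x + δ x v ≡ raiseAt d v (suc j) x
    by-position (yes refl) rewrite raiseAt-at j | raiseAt-at (suc j) | δ-refl x =
      trans (ℕ.+-assoc (d x) j 1) (cong (d x +_) (ℕ.+-comm j 1))
    by-position (no x≢v) rewrite raiseAt-off j x≢v | raiseAt-off (suc j) x≢v | δ-≢ x≢v =
      ℕ.+-identityʳ (d x)

  raiseAt-mono : ∀ {i j} x → i ≤ j → raiseAt d v i x ≤ raiseAt d v j x
  raiseAt-mono {i} {j} x i≤j = by-position (x ≟ v)
    where
    by-position : Dec (x ≡ v) → raiseAt d v i x ≤ raiseAt d v j x
    by-position (yes refl) rewrite raiseAt-at i | raiseAt-at j = ℕ.+-monoʳ-≤ (d x) i≤j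
    by-position (no x≢v) rewrite raiseAt-off i x≢v | raiseAt-off j x≢v = ℕ.≤-refl

∧-elimˡ : ∀ {a b} → a ∧ b ≡ true → a ≡ true
∧-elimˡ {true}  _ = refl
∧-elimˡ {false} ()

∧-elimʳ : ∀ {a b} → a ∧ b ≡ true → b ≡ true
∧-elimʳ {true}  e = e
∧-elimʳ {false} ()

not-elim : ∀ {a} → not a ≡ true → a ≡ false
not-elim {false} _ = refl
not-elim {true}  ()

module _ {n} {G : Graph n} (td : TreeDecomposition G) (α : Fin (m td)) where

  edge-target-in-V : ∀ {u w} → Eα td α u w ≡ true → Vs td α w ≡ true
  edge-target-in-V {u} {w} e = ∧-elimˡ (∧-elimʳ {Vs td α u} (∧-elimʳ {E G u w} e))

  Y⇒∉X : ∀ {y} → Ys td α y ≡ true → Xs td α y ≡ false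
  Y⇒∉X {y} y∈Y = not-elim (∧-elimʳ {Vs td α y} y∈Y)

  V∖X⇒Y : ∀ {y} → Vs td α y ≡ true → Xs td α y ≡ false → Ys td α y ≡ true
  V∖X⇒Y y∈V y∉X = cong₂ (λ a b → a ∧ not b) y∈V y∉X

  X≢Y : ∀ {x y} → Xs td α x ≡ true → Ys td α y ≡ true → x ≢ y
  X≢Y x∈X y∈Y refl = contradiction (Y⇒∉X y∈Y) (not-¬ x∈X)

restrictedSum : ∀ {n} → (Fin n → Bool) → (Fin n → ℕ) → ℕ
restrictedSum Y f = sum λ y → if Y y then f y else 0

positive-count-bound : ∀ {n} (Y : Fin n → Bool) (f g : Fin n → ℕ) →
  (∀ y → Y y ≡ true → f y ≤ g y) →
  countF (λ y → Y y ∧ (0 <ᵇ g y)) + restrictedSum Y f ≤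
  countF (λ y → Y y ∧ (0 <ᵇ f y)) + restrictedSum Y g
positive-count-bound {n} Y f g f≤g = begin
  countF G⁺ + restrictedSum Y f               ≡⟨ cong (_+ restrictedSum Y f) (countF≡sum G⁺) ⟩
  sum (iverson ∘ G⁺) + restrictedSum Y f      ≡⟨ ∑-distrib-+ (iverson ∘ G⁺) (restricted f) ⟨
  sum (λ y → iverson (G⁺ y) + restricted f y) ≤⟨ sum-mono pointwise ⟩
  sum (λ y → iverson (F⁺ y) + restricted g y) ≡⟨ ∑-distrib-+ (iverson ∘ F⁺) (restricted g) ⟩
  sum (iverson ∘ F⁺) + restrictedSum Y g      ≡⟨ cong (_+ restrictedSum Y g) (countF≡sum F⁺) ⟨
  countF F⁺ + restrictedSum Y g               ∎
  where
  open ℕ.≤-Reasoning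
  F⁺ G⁺ : Fin n → Bool
  F⁺ y = Y y ∧ (0 <ᵇ f y)
  G⁺ y = Y y ∧ (0 <ᵇ g y)
  restricted : (Fin n → ℕ) → Fin n → ℕ
  restricted h y = if Y y then h y else 0

  positive-step : ∀ a b → a ≤ b → iverson (0 <ᵇ b) + a ≤ iverson (0 <ᵇ a) + b
  positive-step zero    zero    _  = z≤n
  positive-step zero    (suc b) _  = s≤s z≤n
  positive-step (suc a) (suc b) a≤b = s≤s a≤b

  pointwise : ∀ y → iverson (G⁺ y) + restricted f y ≤ iverson (F⁺ y) + restricted g y
  pointwise y with Y y in y∈Y
  ... | false = z≤n
  ... | true  = positive-step (f y) (g y) (f≤g y y∈Y)

module Raising {n} {G : Graph n} (td : TreeDecomposition G) (α : Fin (m td)) (c d : Fin n → ℕ)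
  (v : Fin n) (p : ℕ) {O B : BoolRel n}
  (orO : IsOrientation td α O) (outO : ∀ x → Xs td α x ≡ true → d x ≡ outdeg td O x)
  (capO : ∀ y → Ys td α y ≡ true → indeg td O y ≤ c y)
  (orB : IsOrientation td α B) (outB : ∀ x → Xs td α x ≡ true → raiseAt d v p x ≡ outdeg td B x)
  (capB : ∀ y → Ys td α y ≡ true → indeg td B y ≤ c y)
  (v∈X : Xs td α v ≡ true) where

  indegY : BoolRel n → ℕ
  indegY A = restrictedSum (Ys td α) (indeg td A)

  record Stage (j : ℕ) : Set where
    field
      A             : BoolRel n
      orientation   : IsOrientation td α A
      outdeg-X      : ∀ x → Xs td α x ≡ true → raiseAt d v j x ≡ outdeg td A x
      indeg-Y       : ∀ y → Ys td α y ≡ true → indeg td O y ≤ indeg td A y × indeg td A y ≤ c y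
      indegY-growth : indegY A ≡ indegY O + j

  stage-zero : Stage 0
  stage-zero = record
    { A = O ; orientation = orO
    ; outdeg-X = λ x x∈X → trans (raiseAt-zero d v x) (outO x x∈X)
    ; indeg-Y = λ y y∈Y → ℕ.≤-refl , capO y y∈Y
    ; indegY-growth = sym (ℕ.+-identityʳ (indegY O)) }

  stage-suc : ∀ {j} → j < p → Stage j → Stage (suc j)
  stage-suc {j} j<p S = record
    { A = A′ ; orientation = orientation
    ; outdeg-X = outdeg-X′ ; indeg-Y = indeg-Y′ ; indegY-growth = indegY-growth′ }
    where
    module S = Stage S
    open ℕ.≤-Reasoning

    room : ∀ x → Xs td α x ≡ true → outdeg td S.A x + δ x v ≤ outdeg td B x
    room x x∈X = begin
      outdeg td S.A x + δ x v   ≡⟨ cong (_+ δ x v) (S.outdeg-X x x∈X) ⟨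
      raiseAt d v j x + δ x v   ≡⟨ raiseAt-suc d v j x ⟩
      raiseAt d v (suc j) x     ≤⟨ raiseAt-mono d v x j<p ⟩
      raiseAt d v p x           ≡⟨ outB x x∈X ⟩
      outdeg td B x             ∎

    deficit : outdeg td S.A v < outdeg td B v
    deficit = subst (_≤ outdeg td B v)
                    (trans (cong (outdeg td S.A v +_) (δ-refl v)) (ℕ.+-comm _ 1))
                    (room v v∈X)

    open Augmentation (augment orB (suc (disagreement B S.A)) v (ℕ.n<1+n _) S.orientation deficit)

    end∉X : Xs td α end ≡ false
    end∉X with Xs td α end in end∈X
    ... | false = refl
    ... | true  = contradiction (begin-strict
      outdeg td A′ end            <⟨ ℕ.n<1+n _ ⟩
      suc (outdeg td A′ end)      ≡⟨ ℕ.+-comm 1 _ ⟩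
      outdeg td A′ end + 1        ≡⟨ cong (outdeg td A′ end +_) (δ-refl end) ⟨
      outdeg td A′ end + δ end end ≡⟨ outdeg-shift end ⟩
      outdeg td S.A end + δ end v ≤⟨ room end end∈X ⟩
      outdeg td B end             ≤⟨ end-saturated ⟩
      outdeg td A′ end            ∎) (ℕ.n≮n _)

    end∈Y : Ys td α end ≡ true
    end∈Y = V∖X⇒Y td α (edge-target-in-V td α (proj₂ end-on-edge)) end∉X

    outdeg-X′ : ∀ x → Xs td α x ≡ true → raiseAt d v (suc j) x ≡ outdeg td A′ x
    outdeg-X′ x x∈X = begin-equality
      raiseAt d v (suc j) x     ≡⟨ raiseAt-suc d v j x ⟨
      raiseAt d v j x + δ x v   ≡⟨ cong (_+ δ x v) (S.outdeg-X x x∈X) ⟩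
      outdeg td S.A x + δ x v   ≡⟨ outdeg-shift x ⟨
      outdeg td A′ x + δ x end  ≡⟨ +-δ-≢ (outdeg td A′ x) (X≢Y td α x∈X end∈Y) ⟩
      outdeg td A′ x            ∎

    indeg-Y-shift : ∀ y → Ys td α y ≡ true → indeg td A′ y ≡ indeg td S.A y + δ y end
    indeg-Y-shift y y∈Y = begin-equality
      indeg td A′ y             ≡⟨ +-δ-≢ (indeg td A′ y) (X≢Y td α v∈X y∈Y ∘ sym) ⟨
      indeg td A′ y + δ y v     ≡⟨ complementary-shift {a = outdeg td S.A y} {a′ = outdeg td A′ y}
                                     (orientation-degree-invariant S.orientation orientation y)
                                     (outdeg-shift y) ⟩
      indeg td S.A y + δ y end  ∎

    indeg-Y′ : ∀ y → Ys td α y ≡ true → indeg td O y ≤ indeg td A′ y × indeg td A′ y ≤ c y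
    indeg-Y′ y y∈Y = lower , upper (y ≟ end)
      where
      lower : indeg td O y ≤ indeg td A′ y
      lower = begin
        indeg td O y              ≤⟨ proj₁ (S.indeg-Y y y∈Y) ⟩
        indeg td S.A y            ≤⟨ ℕ.m≤m+n _ _ ⟩
        indeg td S.A y + δ y end  ≡⟨ indeg-Y-shift y y∈Y ⟨
        indeg td A′ y             ∎
      upper : Dec (y ≡ end) → indeg td A′ y ≤ c y
      upper (yes refl) = begin
        indeg td A′ y ≤⟨ complementary-≤ (orientation-degree-invariant orB orientation y)
                                          end-saturated ⟩
        indeg td B y  ≤⟨ capB y y∈Y ⟩
        c y           ∎
      upper (no y≢end) = begin
        indeg td A′ y             ≡⟨ indeg-Y-shift y y∈Y ⟩
        indeg td S.A y + δ y end  ≡⟨ +-δ-≢ (indeg td S.A y) y≢end ⟩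
        indeg td S.A y            ≤⟨ proj₂ (S.indeg-Y y y∈Y) ⟩
        c y                       ∎

    restricted : BoolRel n → Fin n → ℕ
    restricted A y = if Ys td α y then indeg td A y else 0

    restricted-off-end : ∀ y → y ≢ end → restricted A′ y ≡ restricted S.A y
    restricted-off-end y y≢end with Ys td α y in y∈Y
    ... | false = refl
    ... | true  = trans (indeg-Y-shift y y∈Y) (+-δ-≢ (indeg td S.A y) y≢end)

    restricted-end : restricted A′ end ≡ suc (restricted S.A end)
    restricted-end rewrite end∈Y =
      trans (indeg-Y-shift end end∈Y) (trans (cong (indeg td S.A end +_) (δ-refl end)) (ℕ.+-comm _ 1))

    indegY-step : indegY A′ ≡ suc (indegY S.A)
    indegY-step = ℕ.+-cancelʳ-≡ (restricted S.A end) _ _ (begin-equality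
      indegY A′ + restricted S.A end        ≡⟨ sum-update end restricted-off-end ⟩
      indegY S.A + restricted A′ end        ≡⟨ cong (indegY S.A +_) restricted-end ⟩
      indegY S.A + suc (restricted S.A end) ≡⟨ ℕ.+-suc _ _ ⟩
      suc (indegY S.A) + restricted S.A end ∎)

    indegY-growth′ : indegY A′ ≡ indegY O + suc j
    indegY-growth′ = begin-equality
      indegY A′          ≡⟨ indegY-step ⟩
      suc (indegY S.A)   ≡⟨ cong suc S.indegY-growth ⟩
      suc (indegY O + j) ≡⟨ ℕ.+-suc _ j ⟨
      indegY O + suc j   ∎

  stage : ∀ j → j ≤ p → Stage j
  stage zero    _   = stage-zero
  stage (suc j) j<p = stage-suc j<p (stage j (ℕ.<⇒≤ j<p))

  positive-count : ∀ {j} (S : Stage j) →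
    countF (λ y → Ys td α y ∧ (0 <ᵇ indeg td (Stage.A S) y)) ≤
    countF (λ y → Ys td α y ∧ (0 <ᵇ indeg td O y)) + j
  positive-count {j} S = ℕ.+-cancelʳ-≤ (indegY O) _ _ (begin
    count-A + indegY O       ≤⟨ positive-count-bound (Ys td α) (indeg td O) (indeg td A)
                                                     (λ y → proj₁ ∘ indeg-Y y) ⟩
    count-O + indegY A       ≡⟨ cong (count-O +_) indegY-growth ⟩
    count-O + (indegY O + j) ≡⟨ regroup count-O (indegY O) j ⟩
    count-O + j + indegY O   ∎)
    where
    open Stage S
    open ℕ.≤-Reasoning
    count-A count-O : ℕ
    count-A = countF (λ y → Ys td α y ∧ (0 <ᵇ indeg td A y))
    count-O = countF (λ y → Ys td α y ∧ (0 <ᵇ indeg td O y))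
    regroup : ∀ a b c → a + (b + c) ≡ a + c + b
    regroup = solve-∀

lemma10 : ∀ {n} (G : Graph n) (c : Fin n → ℕ) (td : TreeDecomposition G)
            (α : Fin (m td)) (d : Fin n → ℕ) (k : ℕ) (v : Fin n) (p : ℕ) →
            InR td c α d k → Xs td α v ≡ true → 0 < p → k + p ≤ sizeY td α →
            (InR td c α (raiseAt d v p) (sizeY td α) ⇔ InR td c α (raiseAt d v p) (k + p))
lemma10 G c td α d k v p (O , orO , outO , capO , countO , _) v∈X _ k+p≤|Y| = mk⇔ shrink relax
  where
  relax : InR td c α (raiseAt d v p) (k + p) → InR td c α (raiseAt d v p) (sizeY td α)
  relax (B , orB , outB , capB , countB , _) =
    B , orB , outB , capB , ℕ.≤-trans countB k+p≤|Y| , ℕ.≤-refl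

  shrink : InR td c α (raiseAt d v p) (sizeY td α) → InR td c α (raiseAt d v p) (k + p)
  shrink (B , orB , outB , capB , _) =
    A , orientation , outdeg-X , (λ y → proj₂ ∘ indeg-Y y) ,
    ℕ.≤-trans (positive-count C) (ℕ.+-monoˡ-≤ p countO) , k+p≤|Y|
    where
    open Raising td α c d v p orO outO capO orB outB capB v∈X
    C : Stage p
    C = stage p ℕ.≤-refl
    open Stage C
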